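{- For every nonzero integer $m$ and every integer $n$, \[ 25\sum_{k = 1}^n F_{mk}^{\,4} = \frac{F_{2mn+m}\left(L_{2mn + m} + 4(-1)^{mn - 1} L_m\right)}{F_{2m}} + 6n+3 . \]
   Context: $F_n$ and $L_n$ ($n\in\mathbb{Z}$) are the Fibonacci and Lucas numbers: $F_n=F_{n-1}+F_{n-2}$ with $F_0=0$, $F_1=1$; $L_n=L_{n-1}+L_{n-2}$ with $L_0=2$, $L_1=1$; extended to negative indices by $F_{ -n}=(-1)^{n-1}F_n$, $L_{ -n}=(-1)^nL_n$. For $n=0$ the sum $\sum_{k=1}^n$ is empty. For $n<0$ the sum follows the convention $\sum_{k=1}^n a_k=-\sum_{k=n+1}^{0}a_k$. -}

module Defs where

open import Data.Nat as ℕ using (ℕ; zero; suc)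
open import Data.Integer as ℤ using (ℤ; +_; -[1+_]; _+_; _*_; -_; _-_; ∣_∣)
open import Data.Nat.Base using (_%_)

fibℕ : ℕ → ℤ
fibℕ zero = + 0
fibℕ (suc zero) = + 1
fibℕ (suc (suc n)) = fibℕ (suc n) + fibℕ n

lucℕ : ℕ → ℤ
lucℕ zero = + 2
lucℕ (suc zero) = + 1
lucℕ (suc (suc n)) = lucℕ (suc n) + lucℕ n

sgnℕ : ℕ → ℤ
sgnℕ k with k % 2
... | zero = + 1
... | suc _ = - (+ 1)

-- Extension to ℤ: F_{-n} = (-1)^{n-1} F_n, L_{-n} = (-1)^n L_n
F : ℤ → ℤ
F (+ n) = fibℕ n
F -[1+ n ] = sgnℕ n * fibℕ (suc n)

L : ℤ → ℤ
L (+ n) = lucℕ n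
L -[1+ n ] = sgnℕ (suc n) * lucℕ (suc n)

negOnePow : ℤ → ℤ
negOnePow k = sgnℕ ∣ k ∣

sumTo : (ℤ → ℤ) → ℕ → ℤ
sumTo a zero = + 0
sumTo a (suc n) = sumTo a n + a (+ suc n)

sumNeg : (ℤ → ℤ) → ℕ → ℤ
sumNeg a zero = a (+ 0)
sumNeg a (suc j) = sumNeg a j + a (- (+ suc j))

-- Σ_{k=1}^{n} a k with the convention Σ_{k=1}^{n} = - Σ_{k=n+1}^{0} for n < 0
Σ₁ : (ℤ → ℤ) → ℤ → ℤ
Σ₁ a (+ n) = sumTo a n
Σ₁ a -[1+ j ] = - sumNeg a j

-- The two sides agree at n = 0 and have the same increments.  The left side increases by
-- F₂ₘ (25 F⁴ₘₙ − 6); squaring 5 F²ⱼ = L₂ⱼ − 2 (−1)ʲ gives 25 F⁴ⱼ − 6 = L₄ⱼ − 4 (−1)ʲ L₂ⱼ, and both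
-- terms telescope by Lₐ F_b = F_{a+b} − (−1)ᵇ F_{a−b}.  Every identity used comes from the addition
-- formulas 2 F_{a+b} = Fₐ L_b + Lₐ F_b and 2 L_{a+b} = Lₐ L_b + 5 Fₐ F_b over ℤ: both sides satisfy
-- the Fibonacci recurrence in b and agree at b = 0, 1.  At b = −a they give L²ₐ − 5 F²ₐ = 4 (−1)ᵃ.
module Submission where

open import Data.Nat using (zero; suc)
open import Data.Integer using (ℤ; +_; -[1+_]; _+_; _*_; _-_; -_; _^_; ∣_∣)
open import Data.Integer.Properties
  using (+-assoc; +-comm; +-identityˡ; +-identityʳ; +-inverseˡ; +-inverseʳ;
         *-zeroʳ; *-identityˡ; *-identityʳ; *-assoc; *-comm; *-distribˡ-+; *-cancelˡ-≡;
         neg-involutive; neg-injective; neg-distribʳ-*;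
         +-0-abelianGroup; +-commutativeSemigroup)
open import Algebra.Properties.AbelianGroup +-0-abelianGroup
  using () renaming (∙-cancelˡ to +-cancelˡ-≡; ∙-cancelʳ to +-cancelʳ-≡)
open import Algebra.Properties.CommutativeSemigroup +-commutativeSemigroup
  using () renaming (x∙yz≈y∙xz to +-left-comm; interchange to +-interchange)
open import Data.Integer.Tactic.RingSolver using (solve-∀)
open import Data.Product using (_×_; _,_; proj₁)
open import Relation.Binary.PropositionalEquality
  using (_≡_; _≢_; refl; sym; trans; cong; cong₂; module ≡-Reasoning)
open import Defs

open ≡-Reasoning

-- suc (suc n) % 2 reduces to n % 2, so sgnℕ (suc (suc n)) and sgnℕ n are definitionally equal.
sgnℕ-suc : ∀ n → sgnℕ (suc n) ≡ - sgnℕ n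
sgnℕ-suc zero = refl
sgnℕ-suc (suc zero) = refl
sgnℕ-suc (suc (suc n)) = sgnℕ-suc n

neg-sgnℕ-suc : ∀ n → - sgnℕ (suc n) ≡ sgnℕ n
neg-sgnℕ-suc n = trans (cong -_ (sgnℕ-suc n)) (neg-involutive (sgnℕ n))

sgnℕ-square : ∀ n → sgnℕ n * sgnℕ n ≡ + 1
sgnℕ-square zero = refl
sgnℕ-square (suc n) = begin
  sgnℕ (suc n) * sgnℕ (suc n) ≡⟨ cong (λ s → s * s) (sgnℕ-suc n) ⟩
  - sgnℕ n * - sgnℕ n         ≡⟨ neg*neg (sgnℕ n) ⟩
  sgnℕ n * sgnℕ n             ≡⟨ sgnℕ-square n ⟩
  + 1                         ∎
  where
  neg*neg : ∀ x → - x * - x ≡ x * x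
  neg*neg = solve-∀

sgnℕ-cancel : ∀ n x → sgnℕ n * (sgnℕ n * x) ≡ x
sgnℕ-cancel n x = begin
  sgnℕ n * (sgnℕ n * x) ≡⟨ sym (*-assoc (sgnℕ n) (sgnℕ n) x) ⟩
  sgnℕ n * sgnℕ n * x   ≡⟨ cong (_* x) (sgnℕ-square n) ⟩
  + 1 * x               ≡⟨ *-identityˡ x ⟩
  x                     ∎

ℤ-induction : (P : ℤ → Set) → P (+ 0) →
              (∀ k → P k → P (+ 1 + k)) → (∀ k → P (+ 1 + k) → P k) → ∀ k → P k
ℤ-induction P P₀ up down (+ zero)     = P₀
ℤ-induction P P₀ up down (+ suc n)    = up (+ n) (ℤ-induction P P₀ up down (+ n))
ℤ-induction P P₀ up down -[1+ zero ]  = down -[1+ zero ] P₀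
ℤ-induction P P₀ up down -[1+ suc n ] = down -[1+ suc n ] (ℤ-induction P P₀ up down -[1+ n ])

negOnePow-suc : ∀ k → negOnePow (+ 1 + k) ≡ - negOnePow k
negOnePow-suc (+ n)        = sgnℕ-suc n
negOnePow-suc -[1+ zero ]  = refl
negOnePow-suc -[1+ suc n ] = sym (neg-sgnℕ-suc (suc n))

negOnePow-square : ∀ k → negOnePow k * negOnePow k ≡ + 1
negOnePow-square k = sgnℕ-square ∣ k ∣

negOnePow-cancel : ∀ k x → negOnePow k * (negOnePow k * x) ≡ x
negOnePow-cancel k = sgnℕ-cancel ∣ k ∣

negOnePow-+ : ∀ a b → negOnePow (a + b) ≡ negOnePow a * negOnePow b
negOnePow-+ a = ℤ-induction (λ b → negOnePow (a + b) ≡ negOnePow a * negOnePow b)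
  (trans (cong negOnePow (+-identityʳ a)) (sym (*-identityʳ (negOnePow a)))) up down
  where
  stepped : ∀ b → negOnePow (a + (+ 1 + b)) ≡ - negOnePow (a + b)
  stepped b = trans (cong negOnePow (+-left-comm a (+ 1) b)) (negOnePow-suc (a + b))
  stepped-product : ∀ b → negOnePow a * negOnePow (+ 1 + b) ≡ - (negOnePow a * negOnePow b)
  stepped-product b =
    trans (cong (negOnePow a *_) (negOnePow-suc b)) (sym (neg-distribʳ-* (negOnePow a) (negOnePow b)))
  up : ∀ b → negOnePow (a + b) ≡ negOnePow a * negOnePow b →
       negOnePow (a + (+ 1 + b)) ≡ negOnePow a * negOnePow (+ 1 + b)
  up b ih = trans (stepped b) (trans (cong -_ ih) (sym (stepped-product b)))
  down : ∀ b → negOnePow (a + (+ 1 + b)) ≡ negOnePow a * negOnePow (+ 1 + b) →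
         negOnePow (a + b) ≡ negOnePow a * negOnePow b
  down b ih = neg-injective (trans (sym (stepped b)) (trans ih (stepped-product b)))

2*k≡k+k : ∀ k → + 2 * k ≡ k + k
2*k≡k+k = solve-∀

negOnePow-double : ∀ k → negOnePow (+ 2 * k) ≡ + 1
negOnePow-double k = begin
  negOnePow (+ 2 * k)       ≡⟨ cong negOnePow (2*k≡k+k k) ⟩
  negOnePow (k + k)         ≡⟨ negOnePow-+ k k ⟩
  negOnePow k * negOnePow k ≡⟨ negOnePow-square k ⟩
  + 1                       ∎

negOnePow-pred : ∀ k → negOnePow (k - + 1) ≡ - negOnePow k
negOnePow-pred k = trans (negOnePow-+ k (- + 1)) (*-1 (negOnePow k))
  where
  *-1 : ∀ x → x * - + 1 ≡ - x
  *-1 = solve-∀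

-- Sequences satisfying the Fibonacci recurrence

record Recurrent (x : ℤ → ℤ) : Set where
  field step : ∀ k → x (+ 2 + k) ≡ x (+ 1 + k) + x k
open Recurrent

Recurrent-shift : ∀ {x} a → Recurrent x → Recurrent (λ k → x (a + k))
Recurrent-shift {x} a rec .step k = begin
  x (a + (+ 2 + k))             ≡⟨ cong x (+-left-comm a (+ 2) k) ⟩
  x (+ 2 + (a + k))             ≡⟨ rec .step (a + k) ⟩
  x (+ 1 + (a + k)) + x (a + k) ≡⟨ cong (λ i → x i + x (a + k)) (+-left-comm (+ 1) a k) ⟩
  x (a + (+ 1 + k)) + x (a + k) ∎

Recurrent-scale : ∀ {x} c → Recurrent x → Recurrent (λ k → c * x k)
Recurrent-scale c rec .step k = trans (cong (c *_) (rec .step k)) (*-distribˡ-+ c _ _)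

Recurrent-+ : ∀ {x y} → Recurrent x → Recurrent y → Recurrent (λ k → x k + y k)
Recurrent-+ {x} {y} recx recy .step k =
  trans (cong₂ _+_ (recx .step k) (recy .step k))
        (+-interchange (x (+ 1 + k)) (x k) (y (+ 1 + k)) (y k))

Recurrent-unique : ∀ {x y} → Recurrent x → Recurrent y →
                   x (+ 0) ≡ y (+ 0) → x (+ 1) ≡ y (+ 1) → ∀ k → x k ≡ y k
Recurrent-unique {x} {y} recx recy e₀ e₁ k = proj₁ (ℤ-induction Agree (e₀ , e₁) up down k)
  where
  Agree : ℤ → Set
  Agree k = x k ≡ y k × x (+ 1 + k) ≡ y (+ 1 + k)
  next : ∀ z → Recurrent z → ∀ k → z (+ 1 + (+ 1 + k)) ≡ z (+ 1 + k) + z k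
  next z rec k = trans (cong z (sym (+-assoc (+ 1) (+ 1) k))) (rec .step k)
  up : ∀ k → Agree k → Agree (+ 1 + k)
  up k (eₖ , eₖ₊₁) =
    eₖ₊₁ , trans (next x recx k) (trans (cong₂ _+_ eₖ₊₁ eₖ) (sym (next y recy k)))
  down : ∀ k → Agree (+ 1 + k) → Agree k
  down k (eₖ₊₁ , eₖ₊₂) =
    +-cancelˡ-≡ (x (+ 1 + k)) (x k) (y k)
      (trans (sym (next x recx k)) (trans eₖ₊₂ (trans (next y recy k) (cong (_+ y k) (sym eₖ₊₁))))) ,
    eₖ₊₁

increments-determine : ∀ (x y : ℤ → ℤ) → x (+ 0) ≡ y (+ 0) →
  (∀ k → x (+ 1 + k) - x k ≡ y (+ 1 + k) - y k) → ∀ k → x k ≡ y k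
increments-determine x y e₀ δ = ℤ-induction (λ k → x k ≡ y k) e₀ up down
  where
  up : ∀ k → x k ≡ y k → x (+ 1 + k) ≡ y (+ 1 + k)
  up k eₖ = +-cancelʳ-≡ (- x k) (x (+ 1 + k)) (y (+ 1 + k))
    (trans (δ k) (cong (λ t → y (+ 1 + k) - t) (sym eₖ)))
  down : ∀ k → x (+ 1 + k) ≡ y (+ 1 + k) → x k ≡ y k
  down k eₖ₊₁ = neg-injective (+-cancelˡ-≡ (y (+ 1 + k)) (- x k) (- y k)
    (trans (cong (λ t → t - x k) (sym eₖ₊₁)) (δ k)))

-- Fibonacci–Lucas identities

backward-step : ∀ s a b → s * a ≡ - s * (a + b) + s * ((a + b) + a)
backward-step = solve-∀

F-recurrent : Recurrent F
F-recurrent .step (+ n)                = refl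
F-recurrent .step -[1+ zero ]          = refl
F-recurrent .step -[1+ suc zero ]      = refl
F-recurrent .step -[1+ suc (suc j) ] =
  trans (backward-step (sgnℕ j) (fibℕ (suc j)) (fibℕ j))
        (cong (λ s → s * fibℕ (suc (suc j)) + F -[1+ suc (suc j) ]) (sym (sgnℕ-suc j)))

L-recurrent : Recurrent L
L-recurrent .step (+ n)                = refl
L-recurrent .step -[1+ zero ]          = refl
L-recurrent .step -[1+ suc zero ]      = refl
L-recurrent .step -[1+ suc (suc j) ] =
  trans (backward-step (sgnℕ (suc j)) (lucℕ (suc j)) (lucℕ j))
        (cong (λ s → s * lucℕ (suc (suc j)) + L -[1+ suc (suc j) ]) (sym (sgnℕ-suc (suc j))))

F-neg : ∀ k → F (- k) ≡ - negOnePow k * F k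
F-neg (+ zero)  = refl
F-neg (+ suc n) = cong (_* fibℕ (suc n)) (sym (neg-sgnℕ-suc n))
F-neg -[1+ n ]  =
  sym (trans (cong (_* (sgnℕ n * fibℕ (suc n))) (neg-sgnℕ-suc n)) (sgnℕ-cancel n (fibℕ (suc n))))

L-neg : ∀ k → L (- k) ≡ negOnePow k * L k
L-neg (+ zero)  = refl
L-neg (+ suc n) = refl
L-neg -[1+ n ]  = sym (sgnℕ-cancel (suc n) (lucℕ (suc n)))

F-suc : ∀ a → + 2 * F (+ 1 + a) ≡ F a + L a
F-suc = Recurrent-unique
  (Recurrent-scale (+ 2) (Recurrent-shift (+ 1) F-recurrent))
  (Recurrent-+ F-recurrent L-recurrent)
  refl refl

L-suc : ∀ a → + 2 * L (+ 1 + a) ≡ + 5 * F a + L a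
L-suc = Recurrent-unique
  (Recurrent-scale (+ 2) (Recurrent-shift (+ 1) L-recurrent))
  (Recurrent-+ (Recurrent-scale (+ 5) F-recurrent) L-recurrent)
  refl refl

doubled-at-zero : ∀ u v → + 2 * u ≡ u * + 2 + v * + 0
doubled-at-zero = solve-∀

F-+ : ∀ a b → + 2 * F (a + b) ≡ F a * L b + L a * F b
F-+ a = Recurrent-unique
  (Recurrent-scale (+ 2) (Recurrent-shift a F-recurrent))
  (Recurrent-+ (Recurrent-scale (F a) L-recurrent) (Recurrent-scale (L a) F-recurrent))
  (trans (cong (λ i → + 2 * F i) (+-identityʳ a)) (doubled-at-zero (F a) (L a)))
  (trans (cong (λ i → + 2 * F i) (+-comm a (+ 1))) (trans (F-suc a) (at-one (F a) (L a))))
  where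
  at-one : ∀ f l → f + l ≡ f * + 1 + l * + 1
  at-one = solve-∀

L-+ : ∀ a b → + 2 * L (a + b) ≡ L a * L b + + 5 * F a * F b
L-+ a = Recurrent-unique
  (Recurrent-scale (+ 2) (Recurrent-shift a L-recurrent))
  (Recurrent-+ (Recurrent-scale (L a) L-recurrent) (Recurrent-scale (+ 5 * F a) F-recurrent))
  (trans (cong (λ i → + 2 * L i) (+-identityʳ a)) (doubled-at-zero (L a) (+ 5 * F a)))
  (trans (cong (λ i → + 2 * L i) (+-comm a (+ 1))) (trans (L-suc a) (at-one (F a) (L a))))
  where
  at-one : ∀ f l → + 5 * f + l ≡ l * + 1 + + 5 * f * + 1
  at-one = solve-∀

L²-5F²≡4σ : ∀ k → L k * L k - + 5 * (F k * F k) ≡ + 4 * negOnePow k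
L²-5F²≡4σ k = begin
  L k * L k - + 5 * (F k * F k)                   ≡⟨ sym (negOnePow-cancel k _) ⟩
  σ * (σ * (L k * L k - + 5 * (F k * F k)))       ≡⟨ cong (σ *_) (spread σ (L k) (F k)) ⟩
  σ * (L k * (σ * L k) + + 5 * F k * (- σ * F k))
    ≡⟨ cong (σ *_) (sym (cong₂ (λ l f → L k * l + + 5 * F k * f) (L-neg k) (F-neg k))) ⟩
  σ * (L k * L (- k) + + 5 * F k * F (- k))       ≡⟨ cong (σ *_) (sym (L-+ k (- k))) ⟩
  σ * (+ 2 * L (k + - k))                         ≡⟨ cong (λ i → σ * (+ 2 * L i)) (+-inverseʳ k) ⟩
  σ * + 4                                         ≡⟨ *-comm σ (+ 4) ⟩
  + 4 * σ                                         ∎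
  where
  σ = negOnePow k
  spread : ∀ σ l f → σ * (l * l - + 5 * (f * f)) ≡ l * (σ * l) + + 5 * f * (- σ * f)
  spread = solve-∀

F-double : ∀ k → F (+ 2 * k) ≡ F k * L k
F-double k = *-cancelˡ-≡ (+ 2) _ _ (begin
  + 2 * F (+ 2 * k)     ≡⟨ cong (λ i → + 2 * F i) (2*k≡k+k k) ⟩
  + 2 * F (k + k)       ≡⟨ F-+ k k ⟩
  F k * L k + L k * F k ≡⟨ symmetric-sum (F k) (L k) ⟩
  + 2 * (F k * L k)     ∎)
  where
  symmetric-sum : ∀ f l → f * l + l * f ≡ + 2 * (f * l)
  symmetric-sum = solve-∀

L-double : ∀ k → L (+ 2 * k) ≡ L k * L k - + 2 * negOnePow k
L-double k = *-cancelˡ-≡ (+ 2) _ _ (begin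
  + 2 * L (+ 2 * k)                                   ≡⟨ cong (λ i → + 2 * L i) (2*k≡k+k k) ⟩
  + 2 * L (k + k)                                     ≡⟨ L-+ k k ⟩
  L k * L k + + 5 * F k * F k                         ≡⟨ regroup (L k) (F k) ⟩
  + 2 * (L k * L k) - (L k * L k - + 5 * (F k * F k)) ≡⟨ cong (λ t → + 2 * (L k * L k) - t) (L²-5F²≡4σ k) ⟩
  + 2 * (L k * L k) - + 4 * negOnePow k               ≡⟨ factor (L k) (negOnePow k) ⟩
  + 2 * (L k * L k - + 2 * negOnePow k)               ∎)
  where
  regroup : ∀ l f → l * l + + 5 * f * f ≡ + 2 * (l * l) - (l * l - + 5 * (f * f))
  regroup = solve-∀
  factor : ∀ l σ → + 2 * (l * l) - + 4 * σ ≡ + 2 * (l * l - + 2 * σ)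
  factor = solve-∀

5F²≡L[2k]-2σ : ∀ k → + 5 * (F k * F k) ≡ L (+ 2 * k) - + 2 * negOnePow k
5F²≡L[2k]-2σ k = begin
  + 5 * (F k * F k)                                           ≡⟨ regroup (L k) (F k) σ ⟩
  L k * L k - + 2 * σ - (L k * L k - + 5 * (F k * F k) - + 2 * σ)
    ≡⟨ cong₂ (λ p q → p - (q - + 2 * σ)) (sym (L-double k)) (L²-5F²≡4σ k) ⟩
  L (+ 2 * k) - (+ 4 * σ - + 2 * σ)                           ≡⟨ cancel (L (+ 2 * k)) σ ⟩
  L (+ 2 * k) - + 2 * σ                                       ∎
  where
  σ = negOnePow k
  regroup : ∀ l f σ → + 5 * (f * f) ≡ l * l - + 2 * σ - (l * l - + 5 * (f * f) - + 2 * σ)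
  regroup = solve-∀
  cancel : ∀ l σ → l - (+ 4 * σ - + 2 * σ) ≡ l - + 2 * σ
  cancel = solve-∀

L-mul-F : ∀ a b → L a * F b ≡ F (a + b) - negOnePow b * F (a - b)
L-mul-F a b = *-cancelˡ-≡ (+ 2) _ _ (sym (begin
  + 2 * (F (a + b) - σ * F (a - b))                  ≡⟨ distribute (F (a + b)) (F (a - b)) σ ⟩
  + 2 * F (a + b) - σ * (+ 2 * F (a - b))            ≡⟨ cong₂ (λ p q → p - σ * q) (F-+ a b) (F-+ a (- b)) ⟩
  sum - σ * (F a * L (- b) + L a * F (- b))          ≡⟨ cong₂ (λ l f → sum - σ * (F a * l + L a * f)) (L-neg b) (F-neg b) ⟩
  sum - σ * (F a * (σ * L b) + L a * (- σ * F b))    ≡⟨ cong (λ t → sum - t) (factor-sign (F a) (L a) (F b) (L b) σ) ⟩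
  sum - σ * (σ * (F a * L b - L a * F b))            ≡⟨ cong (λ t → sum - t) (negOnePow-cancel b _) ⟩
  sum - (F a * L b - L a * F b)                      ≡⟨ cancel (F a) (L a) (F b) (L b) ⟩
  + 2 * (L a * F b)                                  ∎))
  where
  σ = negOnePow b
  sum = F a * L b + L a * F b
  distribute : ∀ p q σ → + 2 * (p - σ * q) ≡ + 2 * p - σ * (+ 2 * q)
  distribute = solve-∀
  factor-sign : ∀ fa la fb lb σ → σ * (fa * (σ * lb) + la * (- σ * fb)) ≡ σ * (σ * (fa * lb - la * fb))
  factor-sign = solve-∀
  cancel : ∀ fa la fb lb → (fa * lb + la * fb) - (fa * lb - la * fb) ≡ + 2 * (la * fb)
  cancel = solve-∀

25F⁴≡L[4j]-4σL[2j]+6 : ∀ j → + 25 * F j ^ 4 ≡ L (+ 4 * j) - + 4 * negOnePow j * L (+ 2 * j) + + 6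
25F⁴≡L[4j]-4σL[2j]+6 j = begin
  + 25 * F j ^ 4                                              ≡⟨ square-of-square (F j) ⟩
  + 5 * (F j * F j) * (+ 5 * (F j * F j))                     ≡⟨ cong (λ t → t * t) (5F²≡L[2k]-2σ j) ⟩
  (L₂ - + 2 * σ) * (L₂ - + 2 * σ)                             ≡⟨ expand L₂ σ ⟩
  (L₂ * L₂ - + 2) - + 4 * σ * L₂ + + 4 * (σ * (σ * + 1)) + + 2
    ≡⟨ cong₂ (λ p q → p - + 4 * σ * L₂ + + 4 * q + + 2) (sym L₄≡L₂²-2) (negOnePow-cancel j (+ 1)) ⟩
  L (+ 4 * j) - + 4 * σ * L₂ + + 4 * + 1 + + 2                ≡⟨ constants (L (+ 4 * j)) (+ 4 * σ * L₂) ⟩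
  L (+ 4 * j) - + 4 * σ * L₂ + + 6                            ∎
  where
  σ = negOnePow j
  L₂ = L (+ 2 * j)
  four*j : ∀ j → + 4 * j ≡ + 2 * (+ 2 * j)
  four*j = solve-∀
  L₄≡L₂²-2 : L (+ 4 * j) ≡ L₂ * L₂ - + 2
  L₄≡L₂²-2 = begin
    L (+ 4 * j)                         ≡⟨ cong L (four*j j) ⟩
    L (+ 2 * (+ 2 * j))                 ≡⟨ L-double (+ 2 * j) ⟩
    L₂ * L₂ - + 2 * negOnePow (+ 2 * j) ≡⟨ cong (λ t → L₂ * L₂ - + 2 * t) (negOnePow-double j) ⟩
    L₂ * L₂ - + 2                       ∎
  -- The solver does not unfold _^_; f ^ 4 is definitionally f * (f * (f * (f * + 1))).
  square-of-square : ∀ f → + 25 * (f * (f * (f * (f * + 1)))) ≡ + 5 * (f * f) * (+ 5 * (f * f))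
  square-of-square = solve-∀
  expand : ∀ l σ → (l - + 2 * σ) * (l - + 2 * σ) ≡ (l * l - + 2) - + 4 * σ * l + + 4 * (σ * (σ * + 1)) + + 2
  expand = solve-∀
  constants : ∀ l t → l - t + + 4 * + 1 + + 2 ≡ l - t + + 6
  constants = solve-∀

-- Telescoping

closedForm : ℤ → ℤ → ℤ
closedForm m j = F (+ 2 * j + m) * (L (+ 2 * j + m) - + 4 * negOnePow j * L m)

FL-telescopes : ∀ m j →
  F (+ 2 * (m + j) + m) * L (+ 2 * (m + j) + m) - F (+ 2 * j + m) * L (+ 2 * j + m)
    ≡ F (+ 2 * m) * L (+ 4 * (m + j))
FL-telescopes m j = begin
  F u * L u - F v * L v                ≡⟨ cong₂ _-_ (sym (F-double u)) (sym (F-double v)) ⟩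
  F (+ 2 * u) - F (+ 2 * v)            ≡⟨ cong₂ (λ p q → F p - F q) (outer m j) (inner m j) ⟩
  F (a + b) - F (a - b)                ≡⟨ cong (λ t → F (a + b) - t) (sym unsigned) ⟩
  F (a + b) - negOnePow b * F (a - b)  ≡⟨ sym (L-mul-F a b) ⟩
  L a * F b                            ≡⟨ *-comm (L a) (F b) ⟩
  F b * L a                            ∎
  where
  u = + 2 * (m + j) + m
  v = + 2 * j + m
  a = + 4 * (m + j)
  b = + 2 * m
  outer : ∀ m j → + 2 * (+ 2 * (m + j) + m) ≡ + 4 * (m + j) + + 2 * m
  outer = solve-∀
  inner : ∀ m j → + 2 * (+ 2 * j + m) ≡ + 4 * (m + j) - + 2 * m
  inner = solve-∀
  unsigned : negOnePow b * F (a - b) ≡ F (a - b)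
  unsigned = trans (cong (_* F (a - b)) (negOnePow-double m)) (*-identityˡ (F (a - b)))

signed-F-telescopes : ∀ m j →
  negOnePow (m + j) * F (+ 2 * (m + j) + m) - negOnePow j * F (+ 2 * j + m)
    ≡ negOnePow (m + j) * (F m * L (+ 2 * (m + j)))
signed-F-telescopes m j = begin
  σ * F u - negOnePow j * F v            ≡⟨ cong (λ t → σ * F u - t * F v) σⱼ≡σ*τ ⟩
  σ * F u - σ * τ * F v                  ≡⟨ factor σ τ (F u) (F v) ⟩
  σ * (F u - τ * F v)                    ≡⟨ cong (λ i → σ * (F u - τ * F i)) (reflected m j) ⟩
  σ * (F u - τ * F (+ 2 * (m + j) - m))  ≡⟨ cong (σ *_) (sym (L-mul-F (+ 2 * (m + j)) m)) ⟩
  σ * (L (+ 2 * (m + j)) * F m)          ≡⟨ cong (σ *_) (*-comm (L (+ 2 * (m + j))) (F m)) ⟩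
  σ * (F m * L (+ 2 * (m + j)))          ∎
  where
  σ = negOnePow (m + j)
  τ = negOnePow m
  u = + 2 * (m + j) + m
  v = + 2 * j + m
  σⱼ≡σ*τ : negOnePow j ≡ σ * τ
  σⱼ≡σ*τ = begin
    negOnePow j           ≡⟨ sym (negOnePow-cancel m (negOnePow j)) ⟩
    τ * (τ * negOnePow j) ≡⟨ cong (τ *_) (sym (negOnePow-+ m j)) ⟩
    τ * σ                 ≡⟨ *-comm τ σ ⟩
    σ * τ                 ∎
  factor : ∀ σ τ p q → σ * p - σ * τ * q ≡ σ * (p - τ * q)
  factor = solve-∀
  reflected : ∀ m j → + 2 * j + m ≡ + 2 * (m + j) - m
  reflected = solve-∀

F⁴-telescopes : ∀ m j →
  F (+ 2 * m) * (+ 25 * F (m + j) ^ 4 - + 6) ≡ closedForm m (m + j) - closedForm m j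
F⁴-telescopes m j = begin
  A * (+ 25 * F i ^ 4 - + 6)
    ≡⟨ cong (λ t → A * (t - + 6)) (25F⁴≡L[4j]-4σL[2j]+6 i) ⟩
  A * (L (+ 4 * i) - + 4 * σ * L₂ + + 6 - + 6)
    ≡⟨ split A (L (+ 4 * i)) σ L₂ ⟩
  A * L (+ 4 * i) - + 4 * σ * (A * L₂)
    ≡⟨ cong (λ t → A * L (+ 4 * i) - + 4 * σ * (t * L₂)) (F-double m) ⟩
  A * L (+ 4 * i) - + 4 * σ * (F m * L m * L₂)
    ≡⟨ regroup A (L (+ 4 * i)) σ (F m) (L m) L₂ ⟩
  A * L (+ 4 * i) - + 4 * L m * (σ * (F m * L₂))
    ≡⟨ cong₂ (λ p q → p - + 4 * L m * q) (sym (FL-telescopes m j)) (sym (signed-F-telescopes m j)) ⟩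
  (F u * L u - F v * L v) - + 4 * L m * (σ * F u - negOnePow j * F v)
    ≡⟨ recombine (F u) (L u) (F v) (L v) σ (negOnePow j) (L m) ⟩
  closedForm m i - closedForm m j
    ∎
  where
  i = m + j
  A = F (+ 2 * m)
  σ = negOnePow i
  L₂ = L (+ 2 * i)
  u = + 2 * i + m
  v = + 2 * j + m
  split : ∀ A L₄ σ L₂ → A * (L₄ - + 4 * σ * L₂ + + 6 - + 6) ≡ A * L₄ - + 4 * σ * (A * L₂)
  split = solve-∀
  regroup : ∀ A L₄ σ f l L₂ → A * L₄ - + 4 * σ * (f * l * L₂) ≡ A * L₄ - + 4 * l * (σ * (f * L₂))
  regroup = solve-∀
  recombine : ∀ fu lu fv lv σ σⱼ l →
    (fu * lu - fv * lv) - + 4 * l * (σ * fu - σⱼ * fv) ≡ fu * (lu - + 4 * σ * l) - fv * (lv - + 4 * σⱼ * l)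
  recombine = solve-∀

closedForm-multiple : ∀ m n →
  closedForm m (m * n) ≡ F (+ 2 * m * n + m) * (L (+ 2 * m * n + m) + + 4 * negOnePow (m * n - + 1) * L m)
closedForm-multiple m n = begin
  F (+ 2 * (m * n) + m) * (L (+ 2 * (m * n) + m) - + 4 * σ * L m)
    ≡⟨ cong (λ i → F i * (L i - + 4 * σ * L m)) (reassoc m n) ⟩
  F N * (L N - + 4 * σ * L m)
    ≡⟨ cong (F N *_) (flip-sign (L N) σ (L m)) ⟩
  F N * (L N + + 4 * - σ * L m)
    ≡⟨ cong (λ t → F N * (L N + + 4 * t * L m)) (sym (negOnePow-pred (m * n))) ⟩
  F N * (L N + + 4 * negOnePow (m * n - + 1) * L m)
    ∎
  where
  σ = negOnePow (m * n)
  N = + 2 * m * n + m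
  reassoc : ∀ m n → + 2 * (m * n) + m ≡ + 2 * m * n + m
  reassoc = solve-∀
  flip-sign : ∀ l σ b → l - + 4 * σ * b ≡ l + + 4 * - σ * b
  flip-sign = solve-∀

Σ₁-suc : ∀ a n → Σ₁ a (+ 1 + n) ≡ Σ₁ a n + a (+ 1 + n)
Σ₁-suc a (+ n)        = refl
Σ₁-suc a -[1+ zero ]  = sym (+-inverseˡ (a (+ 0)))
Σ₁-suc a -[1+ suc j ] = drop-last (sumNeg a j) (a -[1+ j ])
  where
  drop-last : ∀ s t → - s ≡ - (s + t) + t
  drop-last = solve-∀

scaledQuarticSum : ℤ → ℤ → ℤ
scaledQuarticSum m n = F (+ 2 * m) * (+ 25 * Σ₁ (λ k → F (m * k) ^ 4) n - (+ 6 * n + + 3))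

scaledQuarticSum-zero : ∀ m → scaledQuarticSum m (+ 0) ≡ closedForm m (m * + 0)
scaledQuarticSum-zero m = begin
  F (+ 2 * m) * -[1+ 2 ]         ≡⟨ cong (_* -[1+ 2 ]) (F-double m) ⟩
  F m * L m * -[1+ 2 ]           ≡⟨ minus-three (F m) (L m) ⟩
  F m * (L m - + 4 * + 1 * L m)  ≡⟨ cong (λ i → F i * (L i - + 4 * + 1 * L m)) (sym (+-identityˡ m)) ⟩
  closedForm m (+ 0)             ≡⟨ cong (closedForm m) (sym (*-zeroʳ m)) ⟩
  closedForm m (m * + 0)         ∎
  where
  minus-three : ∀ f l → f * l * -[1+ 2 ] ≡ f * (l - + 4 * + 1 * l)
  minus-three = solve-∀

scaledQuarticSum-increment : ∀ m k →
  scaledQuarticSum m (+ 1 + k) - scaledQuarticSum m k ≡ F (+ 2 * m) * (+ 25 * F (m * (+ 1 + k)) ^ 4 - + 6)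
scaledQuarticSum-increment m k = begin
  scaledQuarticSum m (+ 1 + k) - scaledQuarticSum m k
    ≡⟨ cong (λ t → A * (+ 25 * t - (+ 6 * (+ 1 + k) + + 3)) - scaledQuarticSum m k) (Σ₁-suc a k) ⟩
  A * (+ 25 * (Σ₁ a k + a (+ 1 + k)) - (+ 6 * (+ 1 + k) + + 3)) - A * (+ 25 * Σ₁ a k - (+ 6 * k + + 3))
    ≡⟨ difference A (Σ₁ a k) (a (+ 1 + k)) k ⟩
  A * (+ 25 * F (m * (+ 1 + k)) ^ 4 - + 6)
    ∎
  where
  A = F (+ 2 * m)
  a = λ k → F (m * k) ^ 4
  difference : ∀ A S v k →
    A * (+ 25 * (S + v) - (+ 6 * (+ 1 + k) + + 3)) - A * (+ 25 * S - (+ 6 * k + + 3)) ≡ A * (+ 25 * v - + 6)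
  difference = solve-∀

closedForm-increment : ∀ m k →
  closedForm m (m * (+ 1 + k)) - closedForm m (m * k) ≡ F (+ 2 * m) * (+ 25 * F (m * (+ 1 + k)) ^ 4 - + 6)
closedForm-increment m k = begin
  closedForm m (m * (+ 1 + k)) - closedForm m (m * k)
    ≡⟨ cong (λ i → closedForm m i - closedForm m (m * k)) (next-multiple m k) ⟩
  closedForm m (m + m * k) - closedForm m (m * k)
    ≡⟨ sym (F⁴-telescopes m (m * k)) ⟩
  F (+ 2 * m) * (+ 25 * F (m + m * k) ^ 4 - + 6)
    ≡⟨ cong (λ i → F (+ 2 * m) * (+ 25 * F i ^ 4 - + 6)) (sym (next-multiple m k)) ⟩
  F (+ 2 * m) * (+ 25 * F (m * (+ 1 + k)) ^ 4 - + 6)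
    ∎
  where
  next-multiple : ∀ m k → m * (+ 1 + k) ≡ m + m * k
  next-multiple = solve-∀

mainTheorem1 : (m n : ℤ) → m ≢ + 0 →
    F (+ 2 * m) * (+ 25 * Σ₁ (λ k → F (m * k) ^ 4) n - (+ 6 * n + + 3))
      ≡ F (+ 2 * m * n + m) * (L (+ 2 * m * n + m) + + 4 * negOnePow (m * n - + 1) * L m)
mainTheorem1 m n _ = begin
  scaledQuarticSum m n   ≡⟨ increments-determine (scaledQuarticSum m) (λ n → closedForm m (m * n))
                              (scaledQuarticSum-zero m) same-increments n ⟩
  closedForm m (m * n)   ≡⟨ closedForm-multiple m n ⟩
  F (+ 2 * m * n + m) * (L (+ 2 * m * n + m) + + 4 * negOnePow (m * n - + 1) * L m) ∎
  where
  same-increments : ∀ k → scaledQuarticSum m (+ 1 + k) - scaledQuarticSum m k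
                          ≡ closedForm m (m * (+ 1 + k)) - closedForm m (m * k)
  same-increments k = trans (scaledQuarticSum-increment m k) (sym (closedForm-increment m k))
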